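{- For all terms $M, M'$: if $M\to_{\mathsf v}^* M'$, then $M$ halts if and only if $M'$ halts.
   Context: Terms and values of the call-by-value $\lambda$-calculus are defined by mutual induction from a countably infinite set of variables: values $V ::= x \mid \lambda x.M$ and terms $M,N,L ::= V \mid MN$, up to $\alpha$-conversion, application associating to the left; $\mathrm{fv}(M)$ is the set of free variables and $M\{V/x\}$ capture-avoiding substitution of a value. Root rules: $(\lambda x.M)V \mapsto_{\beta_v} M\{V/x\}$ ($V$ a value); $(\lambda x.M)NL \mapsto_{\sigma_1} (\lambda x.ML)N$ if $x\notin\mathrm{fv}(L)$; $V((\lambda x.L)N) \mapsto_{\sigma_3} (\lambda x.VL)N$ ($V$ a value, $x\notin\mathrm{fv}(V)$); $\mapsto_{\mathsf v}=\mapsto_{\beta_v}\cup\mapsto_{\sigma_1}\cup\mapsto_{\sigma_3}$, and $\to_{\mathsf v}$ is its closure under one-hole contexts $C ::= [\cdot]\mid \lambda x.C\mid CM\mid MC$. $R^*$ is the reflexive-transitive closure of $R$. Head $\beta_v$-reduction $\to_{h\beta_v}$ is the least relation with: $(\lambda x.M)V M_1\dots M_m \to_{h\beta_v} M\{V/x\}M_1\dots M_m$ ($V$ value, $m\ge0$); if $N\to_{h\beta_v}N'$ then $VNM_1\dots M_m\to_{h\beta_v}VN'M_1\dots M_m$ ($V$ value, $m\ge0$). A term $M$ halts if there is a value $V$ with $M\to_{h\beta_v}^* V$. -}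

module Defs where

open import Data.Nat using (ℕ; zero; suc)
open import Data.List using (List; []; _∷_; foldl)
open import Data.Product using (Σ; _×_)
open import Relation.Binary.Construct.Closure.ReflexiveTransitive using (Star)

-- Call-by-value λ-terms up to α-conversion, via (unscoped) de Bruijn indices.
-- Variables are natural numbers (a countably infinite set); open terms allowed.
data Term : Set where
  var : ℕ → Term
  lam : Term → Term
  app : Term → Term → Term

data IsValue : Term → Set where
  v-var : ∀ {n} → IsValue (var n)
  v-lam : ∀ {M} → IsValue (lam M)

ext : (ℕ → ℕ) → ℕ → ℕ
ext ρ zero    = zero
ext ρ (suc n) = suc (ρ n)

rename : (ℕ → ℕ) → Term → Term
rename ρ (var n)   = var (ρ n)
rename ρ (lam M)   = lam (rename (ext ρ) M)
rename ρ (app M N) = app (rename ρ M) (rename ρ N)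

exts : (ℕ → Term) → ℕ → Term
exts σ zero    = var zero
exts σ (suc n) = rename suc (σ n)

subst : (ℕ → Term) → Term → Term
subst σ (var n)   = σ n
subst σ (lam M)   = lam (subst (exts σ) M)
subst σ (app M N) = app (subst σ M) (subst σ N)

-- weakening: corresponds to using a term under a binder whose variable
-- does not occur in it (the side conditions x ∉ fv(L), x ∉ fv(V))
shift : Term → Term
shift = rename suc

sub0 : Term → ℕ → Term
sub0 V zero    = V
sub0 V (suc n) = var n

_[_] : Term → Term → Term
M [ V ] = subst (sub0 V) M

data _↦v_ : Term → Term → Set where
  βv : ∀ {M V} → IsValue V → app (lam M) V ↦v (M [ V ])
  σ1 : ∀ {M N L} → app (app (lam M) N) L ↦v app (lam (app M (shift L))) N
  σ3 : ∀ {V L N} → IsValue V →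
       app V (app (lam L) N) ↦v app (lam (app (shift V) L)) N

data _→v_ : Term → Term → Set where
  root : ∀ {M N} → M ↦v N → M →v N
  ξlam : ∀ {M N} → M →v N → lam M →v lam N
  ξl   : ∀ {M N L} → M →v N → app M L →v app N L
  ξr   : ∀ {M N L} → M →v N → app L M →v app L N

_·*_ : Term → List Term → Term
M ·* Ms = foldl app M Ms

data _→hβv_ : Term → Term → Set where
  hβ  : ∀ {M V} (Ms : List Term) → IsValue V →
        (app (lam M) V ·* Ms) →hβv ((M [ V ]) ·* Ms)
  hξ  : ∀ {V N N'} (Ms : List Term) → IsValue V → N →hβv N' →
        (app V N ·* Ms) →hβv (app V N' ·* Ms)

_→v*_ : Term → Term → Set
_→v*_ = Star _→v_

_→hβv*_ : Term → Term → Set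
_→hβv*_ = Star _→hβv_

Halts : Term → Set
Halts M = Σ Term (λ V → IsValue V × (M →hβv* V))

module Submission where

-- A term halts iff it has a call-by-value big-step evaluation, and head reduction
-- computes exactly that evaluation.  Parallel reduction ⇒, which contains →v, is a
-- simulation for big-step evaluation in both directions, with results related by ⇒.
-- Forward this is an induction on the evaluation; backward the β-redexes of the source
-- must be absorbed, so the induction is on the evaluation and then on the reduction,
-- generalised to a pair of ⇒-related value substitutions.  The σ-rules only re-associate
-- let-like bindings, so the same evaluation steps occur on both sides, reordered.

open import Defs
open import Function.Bundles using (_⇔_; mk⇔)

open import Data.Nat using (ℕ; zero; suc)
open import Data.List using ([]; _∷_; _∷ʳ_)
open import Data.List.Properties using (foldl-∷ʳ)
open import Data.Product using (∃-syntax; _×_; _,_; proj₁; map₂)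
open import Function using (_∘_)
open import Relation.Binary.PropositionalEquality
  using (_≡_; refl; sym; trans; cong; cong₂; subst₂) renaming (subst to ≡-subst)
open import Relation.Binary.Construct.Closure.ReflexiveTransitive using (ε; _◅_; _◅◅_)

infixr 5 _•_
infix 4 _⇒_ _⇓_

_•_ : Term → (ℕ → Term) → ℕ → Term
(W • σ) zero    = W
(W • σ) (suc n) = σ n

ext-cong : ∀ {ρ ρ'} → (∀ n → ρ n ≡ ρ' n) → ∀ n → ext ρ n ≡ ext ρ' n
ext-cong e zero    = refl
ext-cong e (suc n) = cong suc (e n)

rename-cong : ∀ {ρ ρ'} → (∀ n → ρ n ≡ ρ' n) → ∀ M → rename ρ M ≡ rename ρ' M
rename-cong e (var n)   = cong var (e n)
rename-cong e (lam M)   = cong lam (rename-cong (ext-cong e) M)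
rename-cong e (app M N) = cong₂ app (rename-cong e M) (rename-cong e N)

exts-cong : ∀ {σ σ'} → (∀ n → σ n ≡ σ' n) → ∀ n → exts σ n ≡ exts σ' n
exts-cong e zero    = refl
exts-cong e (suc n) = cong (rename suc) (e n)

subst-cong : ∀ {σ σ'} → (∀ n → σ n ≡ σ' n) → ∀ M → subst σ M ≡ subst σ' M
subst-cong e (var n)   = e n
subst-cong e (lam M)   = cong lam (subst-cong (exts-cong e) M)
subst-cong e (app M N) = cong₂ app (subst-cong e M) (subst-cong e N)

rename-rename : ∀ ρ ρ' M → rename ρ (rename ρ' M) ≡ rename (ρ ∘ ρ') M
rename-rename ρ ρ' (var n)   = refl
rename-rename ρ ρ' (lam M)   =
  cong lam (trans (rename-rename (ext ρ) (ext ρ') M) (rename-cong ext-∘ M))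
  where
  ext-∘ : ∀ n → ext ρ (ext ρ' n) ≡ ext (ρ ∘ ρ') n
  ext-∘ zero    = refl
  ext-∘ (suc n) = refl
rename-rename ρ ρ' (app M N) = cong₂ app (rename-rename ρ ρ' M) (rename-rename ρ ρ' N)

subst-rename : ∀ σ ρ M → subst σ (rename ρ M) ≡ subst (σ ∘ ρ) M
subst-rename σ ρ (var n)   = refl
subst-rename σ ρ (lam M)   =
  cong lam (trans (subst-rename (exts σ) (ext ρ) M) (subst-cong exts-ext M))
  where
  exts-ext : ∀ n → exts σ (ext ρ n) ≡ exts (σ ∘ ρ) n
  exts-ext zero    = refl
  exts-ext (suc n) = refl
subst-rename σ ρ (app M N) = cong₂ app (subst-rename σ ρ M) (subst-rename σ ρ N)

rename-subst : ∀ ρ σ M → rename ρ (subst σ M) ≡ subst (rename ρ ∘ σ) M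
rename-subst ρ σ (var n)   = refl
rename-subst ρ σ (lam M)   =
  cong lam (trans (rename-subst (ext ρ) (exts σ) M) (subst-cong ext-exts M))
  where
  ext-exts : ∀ n → rename (ext ρ) (exts σ n) ≡ exts (rename ρ ∘ σ) n
  ext-exts zero    = refl
  ext-exts (suc n) = trans (rename-rename (ext ρ) suc (σ n)) (sym (rename-rename suc ρ (σ n)))
rename-subst ρ σ (app M N) = cong₂ app (rename-subst ρ σ M) (rename-subst ρ σ N)

subst-subst : ∀ τ σ M → subst τ (subst σ M) ≡ subst (subst τ ∘ σ) M
subst-subst τ σ (var n)   = refl
subst-subst τ σ (lam M)   =
  cong lam (trans (subst-subst (exts τ) (exts σ) M) (subst-cong exts-exts M))
  where
  exts-exts : ∀ n → subst (exts τ) (exts σ n) ≡ exts (subst τ ∘ σ) n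
  exts-exts zero    = refl
  exts-exts (suc n) = trans (subst-rename (exts τ) suc (σ n)) (sym (rename-subst suc τ (σ n)))
subst-subst τ σ (app M N) = cong₂ app (subst-subst τ σ M) (subst-subst τ σ N)

subst-var : ∀ M → subst var M ≡ M
subst-var (var n)   = refl
subst-var (lam M)   = cong lam (trans (subst-cong exts-var M) (subst-var M))
  where
  exts-var : ∀ n → exts var n ≡ var n
  exts-var zero    = refl
  exts-var (suc n) = refl
subst-var (app M N) = cong₂ app (subst-var M) (subst-var N)

shift-[] : ∀ W L → shift L [ W ] ≡ L
shift-[] W L = trans (subst-rename (sub0 W) suc L) (subst-var L)

exts-[] : ∀ W τ M → subst (exts τ) M [ W ] ≡ subst (W • τ) M
exts-[] W τ M = trans (subst-subst (sub0 W) (exts τ) M) (subst-cong sub0-exts M)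
  where
  sub0-exts : ∀ n → subst (sub0 W) (exts τ n) ≡ (W • τ) n
  sub0-exts zero    = refl
  sub0-exts (suc n) = shift-[] W (τ n)

exts-shift-[] : ∀ W τ L → subst (exts τ) (shift L) [ W ] ≡ subst τ L
exts-shift-[] W τ L = trans (exts-[] W τ (shift L)) (subst-rename (W • τ) suc L)

subst-[] : ∀ τ V M → subst τ (M [ V ]) ≡ subst (subst τ V • τ) M
subst-[] τ V M = trans (subst-subst τ (sub0 V) M) (subst-cong subst-sub0 M)
  where
  subst-sub0 : ∀ n → subst τ (sub0 V n) ≡ (subst τ V • τ) n
  subst-sub0 zero    = refl
  subst-sub0 (suc n) = refl

rename-[] : ∀ ρ V M → rename ρ (M [ V ]) ≡ rename (ext ρ) M [ rename ρ V ]
rename-[] ρ V M =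
  trans (rename-subst ρ (sub0 V) M)
        (trans (subst-cong rename-sub0 M) (sym (subst-rename (sub0 (rename ρ V)) (ext ρ) M)))
  where
  rename-sub0 : ∀ n → rename ρ (sub0 V n) ≡ sub0 (rename ρ V) (ext ρ n)
  rename-sub0 zero    = refl
  rename-sub0 (suc n) = refl

rename-ext-shift : ∀ ρ L → rename (ext ρ) (shift L) ≡ shift (rename ρ L)
rename-ext-shift ρ L = trans (rename-rename (ext ρ) suc L) (sym (rename-rename suc ρ L))

subst-exts-shift : ∀ τ L → subst (exts τ) (shift L) ≡ shift (subst τ L)
subst-exts-shift τ L = trans (subst-rename (exts τ) suc L) (sym (rename-subst suc τ L))

ValueSubst : (ℕ → Term) → Set
ValueSubst σ = ∀ n → IsValue (σ n)

IsValue-rename : ∀ ρ {V} → IsValue V → IsValue (rename ρ V)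
IsValue-rename ρ v-var = v-var
IsValue-rename ρ v-lam = v-lam

IsValue-subst : ∀ {σ V} → ValueSubst σ → IsValue V → IsValue (subst σ V)
IsValue-subst vσ (v-var {n}) = vσ n
IsValue-subst vσ v-lam       = v-lam

ValueSubst-exts : ∀ {σ} → ValueSubst σ → ValueSubst (exts σ)
ValueSubst-exts vσ zero    = v-var
ValueSubst-exts vσ (suc n) = IsValue-rename suc (vσ n)

ValueSubst-• : ∀ {W σ} → IsValue W → ValueSubst σ → ValueSubst (W • σ)
ValueSubst-• w vσ zero    = w
ValueSubst-• w vσ (suc n) = vσ n

ValueSubst-sub0 : ∀ {W} → IsValue W → ValueSubst (sub0 W)
ValueSubst-sub0 w zero    = w
ValueSubst-sub0 w (suc n) = v-var

data _⇒_ : Term → Term → Set where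
  pvar : ∀ {n} → var n ⇒ var n
  plam : ∀ {M M'} → M ⇒ M' → lam M ⇒ lam M'
  papp : ∀ {M M' N N'} → M ⇒ M' → N ⇒ N' → app M N ⇒ app M' N'
  pβ   : ∀ {M M' V V'} → IsValue V → M ⇒ M' → V ⇒ V' → app (lam M) V ⇒ M' [ V' ]
  pσ1  : ∀ {M M' N N' L L'} → M ⇒ M' → N ⇒ N' → L ⇒ L' →
         app (app (lam M) N) L ⇒ app (lam (app M' (shift L'))) N'
  pσ3  : ∀ {V V' L L' N N'} → IsValue V → V ⇒ V' → L ⇒ L' → N ⇒ N' →
         app V (app (lam L) N) ⇒ app (lam (app (shift V') L')) N'

_⇒ˢ_ : (ℕ → Term) → (ℕ → Term) → Set
σ ⇒ˢ τ = ∀ n → σ n ⇒ τ n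

⇒-refl : ∀ M → M ⇒ M
⇒-refl (var n)   = pvar
⇒-refl (lam M)   = plam (⇒-refl M)
⇒-refl (app M N) = papp (⇒-refl M) (⇒-refl N)

↦v⊆⇒ : ∀ {M N} → M ↦v N → M ⇒ N
↦v⊆⇒ (βv v) = pβ v (⇒-refl _) (⇒-refl _)
↦v⊆⇒ σ1     = pσ1 (⇒-refl _) (⇒-refl _) (⇒-refl _)
↦v⊆⇒ (σ3 v) = pσ3 v (⇒-refl _) (⇒-refl _) (⇒-refl _)

→v⊆⇒ : ∀ {M N} → M →v N → M ⇒ N
→v⊆⇒ (root r) = ↦v⊆⇒ r
→v⊆⇒ (ξlam s) = plam (→v⊆⇒ s)
→v⊆⇒ (ξl s)   = papp (→v⊆⇒ s) (⇒-refl _)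
→v⊆⇒ (ξr s)   = papp (⇒-refl _) (→v⊆⇒ s)

IsValue-⇒ : ∀ {V V'} → IsValue V → V ⇒ V' → IsValue V'
IsValue-⇒ v-var pvar     = v-var
IsValue-⇒ v-lam (plam p) = v-lam

⇒-lam-inv : ∀ {Y B'} → IsValue Y → Y ⇒ lam B' → ∃[ B ] Y ≡ lam B × B ⇒ B'
⇒-lam-inv v-lam (plam p) = _ , refl , p

⇒-rename : ∀ ρ {M M'} → M ⇒ M' → rename ρ M ⇒ rename ρ M'
⇒-rename ρ pvar       = pvar
⇒-rename ρ (plam p)   = plam (⇒-rename (ext ρ) p)
⇒-rename ρ (papp p q) = papp (⇒-rename ρ p) (⇒-rename ρ q)
⇒-rename ρ (pβ {M' = M'} {V' = V'} v p q) =
  ≡-subst (_ ⇒_) (sym (rename-[] ρ V' M'))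
    (pβ (IsValue-rename ρ v) (⇒-rename (ext ρ) p) (⇒-rename ρ q))
⇒-rename ρ (pσ1 {L' = L'} p n l) =
  ≡-subst (λ K → _ ⇒ app (lam (app _ K)) _) (sym (rename-ext-shift ρ L'))
    (pσ1 (⇒-rename (ext ρ) p) (⇒-rename ρ n) (⇒-rename ρ l))
⇒-rename ρ (pσ3 {V' = V'} v vv l n) =
  ≡-subst (λ K → _ ⇒ app (lam (app K _)) _) (sym (rename-ext-shift ρ V'))
    (pσ3 (IsValue-rename ρ v) (⇒-rename ρ vv) (⇒-rename (ext ρ) l) (⇒-rename ρ n))

⇒ˢ-exts : ∀ {σ τ} → σ ⇒ˢ τ → exts σ ⇒ˢ exts τ
⇒ˢ-exts st zero    = pvar
⇒ˢ-exts st (suc n) = ⇒-rename suc (st n)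

⇒ˢ-• : ∀ {W W' σ τ} → W ⇒ W' → σ ⇒ˢ τ → (W • σ) ⇒ˢ (W' • τ)
⇒ˢ-• r st zero    = r
⇒ˢ-• r st (suc n) = st n

⇒ˢ-sub0 : ∀ {W W'} → W ⇒ W' → sub0 W ⇒ˢ sub0 W'
⇒ˢ-sub0 r zero    = r
⇒ˢ-sub0 r (suc n) = pvar

-- The substitutions must be value substitutions: σ n may land in the argument
-- position of a βv- or σ3-redex, which requires a value.
⇒-subst : ∀ {σ τ} → ValueSubst σ → σ ⇒ˢ τ → ∀ {M M'} → M ⇒ M' → subst σ M ⇒ subst τ M'
⇒-subst vσ st (pvar {n})  = st n
⇒-subst vσ st (plam p)    = plam (⇒-subst (ValueSubst-exts vσ) (⇒ˢ-exts st) p)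
⇒-subst vσ st (papp p q)  = papp (⇒-subst vσ st p) (⇒-subst vσ st q)
⇒-subst {τ = τ} vσ st (pβ {M' = M'} {V' = V'} v p q) =
  ≡-subst (_ ⇒_) (trans (exts-[] (subst τ V') τ M') (sym (subst-[] τ V' M')))
    (pβ (IsValue-subst vσ v) (⇒-subst (ValueSubst-exts vσ) (⇒ˢ-exts st) p) (⇒-subst vσ st q))
⇒-subst {τ = τ} vσ st (pσ1 {L' = L'} p n l) =
  ≡-subst (λ K → _ ⇒ app (lam (app _ K)) _) (sym (subst-exts-shift τ L'))
    (pσ1 (⇒-subst (ValueSubst-exts vσ) (⇒ˢ-exts st) p) (⇒-subst vσ st n) (⇒-subst vσ st l))
⇒-subst {τ = τ} vσ st (pσ3 {V' = V'} v vv l n) =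
  ≡-subst (λ K → _ ⇒ app (lam (app K _)) _) (sym (subst-exts-shift τ V'))
    (pσ3 (IsValue-subst vσ v) (⇒-subst vσ st vv)
         (⇒-subst (ValueSubst-exts vσ) (⇒ˢ-exts st) l) (⇒-subst vσ st n))

⇒-[] : ∀ {B B' U U'} → IsValue U → B ⇒ B' → U ⇒ U' → B [ U ] ⇒ B' [ U' ]
⇒-[] u p r = ⇒-subst (ValueSubst-sub0 u) (⇒ˢ-sub0 r) p

data _⇓_ : Term → Term → Set where
  ⇓-value : ∀ {V} → IsValue V → V ⇓ V
  ⇓-app   : ∀ {M N B V W} → M ⇓ lam B → N ⇓ V → B [ V ] ⇓ W → app M N ⇓ W

Evaluates : Term → Set
Evaluates M = ∃[ W ] M ⇓ W

⇓-IsValue : ∀ {M W} → M ⇓ W → IsValue W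
⇓-IsValue (⇓-value v)   = v
⇓-IsValue (⇓-app _ _ d) = ⇓-IsValue d

value-⇓ : ∀ {V W} → IsValue V → V ⇓ W → W ≡ V
value-⇓ v  (⇓-value _)     = refl
value-⇓ () (⇓-app _ _ _)

⇓-σ1 : ∀ {C N L W} → app (app (lam C) N) L ⇓ W → app (lam (app C (shift L))) N ⇓ W
⇓-σ1 {L = L} (⇓-app (⇓-app (⇓-value _) dN dC) dL dB) =
  ⇓-app (⇓-value v-lam) dN (⇓-app dC (≡-subst (_⇓ _) (sym (shift-[] _ L)) dL) dB)

⇓-σ3 : ∀ {V L N W} → app V (app (lam L) N) ⇓ W → app (lam (app (shift V) L)) N ⇓ W
⇓-σ3 {V} (⇓-app dV (⇓-app (⇓-value _) dN dL) dB) =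
  ⇓-app (⇓-value v-lam) dN (⇓-app (≡-subst (_⇓ _) (sym (shift-[] _ V)) dV) dL dB)

⇒-preserves-⇓ : ∀ {M M' W} → M ⇒ M' → M ⇓ W → ∃[ W' ] M' ⇓ W' × W ⇒ W'

⇒-preserves-⇓-app : ∀ {M M' N N' B V W} → M ⇒ M' → N ⇒ N' →
  M ⇓ lam B → N ⇓ V → B [ V ] ⇓ W → ∃[ W' ] app M' N' ⇓ W' × W ⇒ W'
⇒-preserves-⇓-app p q d₁ d₂ d₃ with ⇒-preserves-⇓ p d₁ | ⇒-preserves-⇓ q d₂
... | _ , e₁ , plam r | _ , e₂ , r₂ with ⇒-preserves-⇓ (⇒-[] (⇓-IsValue d₂) r r₂) d₃
... | W' , e₃ , r₃ = W' , ⇓-app e₁ e₂ e₃ , r₃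

⇒-preserves-⇓ pvar     (⇓-value _) = _ , ⇓-value v-var , pvar
⇒-preserves-⇓ (plam p) (⇓-value _) = _ , ⇓-value v-lam , plam p
⇒-preserves-⇓ (papp p q) (⇓-app d₁ d₂ d₃) = ⇒-preserves-⇓-app p q d₁ d₂ d₃
⇒-preserves-⇓ (pβ v p q) (⇓-app (⇓-value _) (⇓-value _) d) = ⇒-preserves-⇓ (⇒-[] v p q) d
⇒-preserves-⇓ (pβ () _ _) (⇓-app _ (⇓-app _ _ _) _)
⇒-preserves-⇓ (pσ1 p n l) (⇓-app d₁ d₂ d₃) =
  map₂ (λ (e , r) → ⇓-σ1 e , r) (⇒-preserves-⇓-app (papp (plam p) n) l d₁ d₂ d₃)
⇒-preserves-⇓ (pσ3 _ vv l n) (⇓-app d₁ d₂ d₃) =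
  map₂ (λ (e , r) → ⇓-σ3 e , r) (⇒-preserves-⇓-app vv (papp (plam l) n) d₁ d₂ d₃)

-- The evaluated term X is only propositionally equal to subst τ B', so that
-- recursion on the evaluation stays structural.
⇒-reflects-⇓-subst : ∀ {B B' σ τ X W'} → B ⇒ B' → ValueSubst σ → σ ⇒ˢ τ →
  X ≡ subst τ B' → X ⇓ W' → ∃[ W ] subst σ B ⇓ W × W ⇒ W'

⇒-reflects-⇓-app : ∀ {S₁ S₂ Y U U' B' W'} → S₁ ⇓ Y → Y ⇒ lam B' → S₂ ⇓ U → U ⇒ U' →
  B' [ U' ] ⇓ W' → ∃[ W ] app S₁ S₂ ⇓ W × W ⇒ W'
⇒-reflects-⇓-app e₁ r₁ e₂ r₂ d with ⇒-lam-inv (⇓-IsValue e₁) r₁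
... | _ , refl , r with ⇒-reflects-⇓-subst r (ValueSubst-sub0 (⇓-IsValue e₂)) (⇒ˢ-sub0 r₂) refl d
... | W , e , r' = W , ⇓-app e₁ e₂ e , r'

⇒-reflects-⇓-subst {σ = σ} (pvar {n}) vσ st refl d =
  σ n , ⇓-value (vσ n) , ≡-subst (σ n ⇒_) (sym (value-⇓ (IsValue-⇒ (vσ n) (st n)) d)) (st n)
⇒-reflects-⇓-subst (plam p) vσ st refl d =
  _ , ⇓-value v-lam ,
  ≡-subst (_ ⇒_) (sym (value-⇓ v-lam d)) (plam (⇒-subst (ValueSubst-exts vσ) (⇒ˢ-exts st) p))
⇒-reflects-⇓-subst (papp p q) vσ st refl (⇓-app d₁ d₂ d₃)
  with ⇒-reflects-⇓-subst p vσ st refl d₁ | ⇒-reflects-⇓-subst q vσ st refl d₂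
... | _ , e₁ , r₁ | _ , e₂ , r₂ = ⇒-reflects-⇓-app e₁ r₁ e₂ r₂ d₃
⇒-reflects-⇓-subst {σ = σ} {τ} (pβ {M = C} {M' = C'} {V = U} {V' = U'} u p q) vσ st eq d
  with ⇒-reflects-⇓-subst p (ValueSubst-• (IsValue-subst vσ u) vσ) (⇒ˢ-• (⇒-subst vσ st q) st)
         (trans eq (subst-[] τ U' C')) d
... | W , e , r =
  W , ⇓-app (⇓-value v-lam) (⇓-value (IsValue-subst vσ u))
            (≡-subst (_⇓ W) (sym (exts-[] (subst σ U) σ C)) e) , r
⇒-reflects-⇓-subst {σ = σ} {τ} (pσ1 {M = C} {M' = C'} {L' = L'} p n l) vσ st refl
    (⇓-app (⇓-value _) d₁ (⇓-app d₂ d₃ d₄))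
  with ⇒-reflects-⇓-subst n vσ st refl d₁
... | V , e₁ , r₁
  with ⇒-reflects-⇓-subst p (ValueSubst-• (⇓-IsValue e₁) vσ) (⇒ˢ-• r₁ st) (exts-[] _ τ C') d₂
     | ⇒-reflects-⇓-subst l vσ st (exts-shift-[] _ τ L') d₃
... | _ , e₂ , r₂ | _ , e₃ , r₃ =
  ⇒-reflects-⇓-app (⇓-app (⇓-value v-lam) e₁ (≡-subst (_⇓ _) (sym (exts-[] V σ C)) e₂))
                   r₂ e₃ r₃ d₄
⇒-reflects-⇓-subst {σ = σ} {τ} (pσ3 {V' = V'} {L = L} {L' = L'} _ vv l n) vσ st refl
    (⇓-app (⇓-value _) d₁ (⇓-app d₂ d₃ d₄))
  with ⇒-reflects-⇓-subst n vσ st refl d₁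
... | X , e₁ , r₁
  with ⇒-reflects-⇓-subst vv vσ st (exts-shift-[] _ τ V') d₂
     | ⇒-reflects-⇓-subst l (ValueSubst-• (⇓-IsValue e₁) vσ) (⇒ˢ-• r₁ st) (exts-[] _ τ L') d₃
... | _ , e₂ , r₂ | _ , e₃ , r₃ =
  ⇒-reflects-⇓-app e₂ r₂ (⇓-app (⇓-value v-lam) e₁ (≡-subst (_⇓ _) (sym (exts-[] X σ L)) e₃))
                   r₃ d₄

⇒-reflects-⇓ : ∀ {M M' W'} → M ⇒ M' → M' ⇓ W' → ∃[ W ] M ⇓ W × W ⇒ W'
⇒-reflects-⇓ {M} p d with ⇒-reflects-⇓-subst p (λ _ → v-var) (λ _ → pvar) (sym (subst-var _)) d
... | W , e , r = W , ≡-subst (_⇓ W) (subst-var M) e , r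

→v*-preserves-Evaluates : ∀ {M M'} → M →v* M' → Evaluates M → Evaluates M'
→v*-preserves-Evaluates ε        h       = h
→v*-preserves-Evaluates (s ◅ ss) (_ , d) =
  →v*-preserves-Evaluates ss (map₂ proj₁ (⇒-preserves-⇓ (→v⊆⇒ s) d))

→v*-reflects-Evaluates : ∀ {M M'} → M →v* M' → Evaluates M' → Evaluates M
→v*-reflects-Evaluates ε        h = h
→v*-reflects-Evaluates (s ◅ ss) h with →v*-reflects-Evaluates ss h
... | _ , d = map₂ proj₁ (⇒-reflects-⇓ (→v⊆⇒ s) d)

⇓-spine : ∀ {X Y} → (∀ {W} → X ⇓ W → Y ⇓ W) → ∀ Ms {W} → (X ·* Ms) ⇓ W → (Y ·* Ms) ⇓ W
⇓-spine f []       = f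
⇓-spine f (Q ∷ Ms) = ⇓-spine (λ { (⇓-app d₁ d₂ d₃) → ⇓-app (f d₁) d₂ d₃ }) Ms

→hβv-expands-⇓ : ∀ {M M' W} → M →hβv M' → M' ⇓ W → M ⇓ W
→hβv-expands-⇓ (hβ Ms v) = ⇓-spine (⇓-app (⇓-value v-lam) (⇓-value v)) Ms
→hβv-expands-⇓ (hξ Ms v s) =
  ⇓-spine (λ { (⇓-app d₁ d₂ d₃) → ⇓-app d₁ (→hβv-expands-⇓ s d₂) d₃ }) Ms

→hβv*-value⇒⇓ : ∀ {M V} → IsValue V → M →hβv* V → M ⇓ V
→hβv*-value⇒⇓ v ε        = ⇓-value v
→hβv*-value⇒⇓ v (s ◅ ss) = →hβv-expands-⇓ s (→hβv*-value⇒⇓ v ss)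

→hβv-appˡ : ∀ {P P' Q} → P →hβv P' → app P Q →hβv app P' Q
→hβv-appˡ {Q = Q} (hβ {M} {V} Ms v) =
  subst₂ _→hβv_ (foldl-∷ʳ app (app (lam M) V) Q Ms) (foldl-∷ʳ app (M [ V ]) Q Ms)
    (hβ (Ms ∷ʳ Q) v)
→hβv-appˡ {Q = Q} (hξ {V} {N} {N'} Ms v s) =
  subst₂ _→hβv_ (foldl-∷ʳ app (app V N) Q Ms) (foldl-∷ʳ app (app V N') Q Ms)
    (hξ (Ms ∷ʳ Q) v s)

→hβv*-appˡ : ∀ {P P' Q} → P →hβv* P' → app P Q →hβv* app P' Q
→hβv*-appˡ ε        = ε
→hβv*-appˡ (s ◅ ss) = →hβv-appˡ s ◅ →hβv*-appˡ ss

→hβv*-appʳ : ∀ {V Q Q'} → IsValue V → Q →hβv* Q' → app V Q →hβv* app V Q'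
→hβv*-appʳ v ε        = ε
→hβv*-appʳ v (s ◅ ss) = hξ [] v s ◅ →hβv*-appʳ v ss

⇓⇒→hβv* : ∀ {M W} → M ⇓ W → M →hβv* W
⇓⇒→hβv* (⇓-value _)      = ε
⇓⇒→hβv* (⇓-app d₁ d₂ d₃) =
  →hβv*-appˡ (⇓⇒→hβv* d₁) ◅◅ →hβv*-appʳ v-lam (⇓⇒→hβv* d₂) ◅◅ hβ [] (⇓-IsValue d₂) ◅ ⇓⇒→hβv* d₃

Halts⇒Evaluates : ∀ {M} → Halts M → Evaluates M
Halts⇒Evaluates (V , v , h) = V , →hβv*-value⇒⇓ v h

Evaluates⇒Halts : ∀ {M} → Evaluates M → Halts M
Evaluates⇒Halts (W , d) = W , ⇓-IsValue d , ⇓⇒→hβv* d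

theorem5p4 : (M M' : Term) → M →v* M' → Halts M ⇔ Halts M'
theorem5p4 M M' s = mk⇔
  (Evaluates⇒Halts ∘ →v*-preserves-Evaluates s ∘ Halts⇒Evaluates)
  (Evaluates⇒Halts ∘ →v*-reflects-Evaluates s ∘ Halts⇒Evaluates)
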